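{- For any implicative frame $\mathfrak{F}=(X,\upharpoonleft,Y,T)$, its full complex algebra $\mathfrak{F}^+=(\mathcal{G}(X),\subseteq,\bigcap,\bigvee,\emptyset,X,\Rightarrow)$ is an integral implicative lattice.
   Context: A sorted frame (polarity) is a triple $(X,\upharpoonleft,Y)$ with $X,Y$ nonempty sets and ${\upharpoonleft}\subseteq X\times Y$. For $U\subseteq X$, $V\subseteq Y$ let $U^{\perp}=\{y\in Y:\forall x\in U\ x\upharpoonleft y\}$ and ${}^{\perp}V=\{x\in X:\forall y\in V\ x\upharpoonleft y\}$. $A\subseteq X$ is stable if $A={}^{\perp}(A^{\perp})$, $B\subseteq Y$ is co-stable if $B=({}^{\perp}B)^{\perp}$; both are called Galois sets. $\mathcal{G}(X)$, $\mathcal{G}(Y)$ are the complete lattices of stable, resp. co-stable, sets (meets are intersections, joins are Galois closures of unions). For $W\subseteq X$ write $W'=W^\perp$, for $W\subseteq Y$ write $W'={}^\perp W$. Preorders: for $x,z\in X$, $x\leq z$ iff $\{x\}^{\perp}\subseteq\{z\}^{\perp}$; for $y,v\in Y$, $y\leq v$ iff ${}^{\perp}\{y\}\subseteq{}^{\perp}\{v\}$; separated means these are partial orders. $\Gamma u=\{w:u\leq w\}$. For $T\subseteq Y\times X\times Y$ (written $yTxv$) its Galois dual $T'\subseteq X\times X\times Y$ is: $uT'xv$ iff for all $y$, $yTxv$ implies $u\upharpoonleft y$. An implicative frame is $(X,\upharpoonleft,Y,T)$ such that: (F0) $x\upharpoonleft y$ iff $uT'xy$ for all $u\in X$; (F1)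 separated; (F2) each set $\{y: yTxv\}$ ($x\in X,v\in Y$) equals $\Gamma w$ for some $w\in Y$; (F3) if $yTxv$, $x_1\leq x$, $v_1\leq v$ then $yTx_1v_1$; (F4) for all $z,x\in X$, $v\in Y$, the sets $\{x_1: zT'x_1v\}$ and $\{v_1: zT'xv_1\}$ are Galois sets. For $A,C\in\mathcal{G}(X)$, $A\Rightarrow C={}^{\perp}\big((\{y:\exists x\in A\,\exists v\in C^{\perp}\ yTxv\})''\big)$. An integral implicative lattice is a bounded lattice with a binary operation $\to$ satisfying (A1) $(a\vee b)\to c=(a\to c)\wedge(b\to c)$, (A2) $a\to(b\wedge c)=(a\to b)\wedge(a\to c)$, (A3) $a\leq b$ iff $1\leq a\to b$. -}

module Defs where

open import Level using (0ℓ)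
open import Data.Product using (Σ; ∃; _×_; _,_; proj₁; proj₂)
open import Data.Empty renaming (⊥ to Empty)
open import Data.Sum using (_⊎_)
open import Data.Unit using (⊤; tt)
open import Relation.Binary.PropositionalEquality using (_≡_)
open import Relation.Binary.Structures using (IsPartialOrder)
open import Relation.Binary.Lattice.Structures using (IsBoundedLattice)
open import Function.Bundles using (_⇔_)

Sub : Set → Set₁
Sub A = A → Set

infix 4 _⊆_ _≐_
_⊆_ : {A : Set} → Sub A → Sub A → Set
U ⊆ V = ∀ a → U a → V a

_≐_ : {A : Set} → Sub A → Sub A → Set
U ≐ V = (U ⊆ V) × (V ⊆ U)

record SortedFrame : Set₁ where
  field
    X    : Set
    Y    : Set
    x₀   : X
    y₀   : Y
    _↿_  : X → Y → Set

  _⊥ : Sub X → Sub Y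
  (U ⊥) y = ∀ x → U x → x ↿ y

  ⊥_ : Sub Y → Sub X
  (⊥ V) x = ∀ y → V y → x ↿ y

  IsStable : Sub X → Set
  IsStable A = A ≐ ⊥ (A ⊥)

  IsCoStable : Sub Y → Set
  IsCoStable B = B ≐ (⊥ B) ⊥

  ⟦_⟧X : X → Sub X
  ⟦ x ⟧X z = x ≡ z

  ⟦_⟧Y : Y → Sub Y
  ⟦ y ⟧Y v = y ≡ v

  _≤X_ : X → X → Set
  x ≤X z = (⟦ x ⟧X ⊥) ⊆ (⟦ z ⟧X ⊥)

  _≤Y_ : Y → Y → Set
  y ≤Y v = (⊥ ⟦ y ⟧Y) ⊆ (⊥ ⟦ v ⟧Y)

  ΓY : Y → Sub Y
  ΓY w v = w ≤Y v

  Separated : Set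
  Separated = (∀ x z → x ≤X z → z ≤X x → x ≡ z)
            × (∀ y v → y ≤Y v → v ≤Y y → y ≡ v)

record ImplicativeFrame : Set₁ where
  field
    frame : SortedFrame
  open SortedFrame frame public
  field
    T : Y → X → Y → Set

  T' : X → X → Y → Set
  T' u x v = ∀ y → T y x v → u ↿ y

  field
    F0 : ∀ x y → (x ↿ y) ⇔ (∀ u → T' u x y)
    F1 : Separated
    F2 : ∀ x v → ∃ λ w → (λ y → T y x v) ≐ ΓY w
    F3 : ∀ y x v x₁ v₁ → T y x v → x₁ ≤X x → v₁ ≤Y v → T y x₁ v₁
    F4 : ∀ z x v → IsStable (λ x₁ → T' z x₁ v) × IsCoStable (λ v₁ → T' z x v₁)

record IsIntegralImplicativeLattice {A : Set₁} (_≈_ _≤_ : A → A → Set)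
         (_∨_ _∧_ : A → A → A) (⊤ ⊥ : A) (_⇒_ : A → A → A) : Set₁ where
  field
    isBoundedLattice : IsBoundedLattice _≈_ _≤_ _∨_ _∧_ ⊤ ⊥
    A1 : ∀ a b c → ((a ∨ b) ⇒ c) ≈ ((a ⇒ c) ∧ (b ⇒ c))
    A2 : ∀ a b c → (a ⇒ (b ∧ c)) ≈ ((a ⇒ b) ∧ (a ⇒ c))
    A3 : ∀ a b → (a ≤ b) ⇔ (⊤ ≤ (a ⇒ b))

module ComplexAlgebra (𝔉 : ImplicativeFrame) where
  open ImplicativeFrame 𝔉

  closure-stable : (V : Sub Y) → IsStable (⊥ V)
  closure-stable V = (λ x p y q → q x p) , (λ x p y q → p y (λ x' r → r y q))

  𝒢X : Set₁
  𝒢X = Σ (Sub X) IsStable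

  _≈G_ : 𝒢X → 𝒢X → Set
  A ≈G B = proj₁ A ≐ proj₁ B

  _⊆G_ : 𝒢X → 𝒢X → Set
  A ⊆G B = proj₁ A ⊆ proj₁ B

  _∩G_ : 𝒢X → 𝒢X → 𝒢X
  (A , sA) ∩G (B , sB) =
    (λ x → A x × B x)
    , (λ x p y q → q x p)
    , (λ x p → proj₂ sA x (λ y q → p y (λ x' r → q x' (proj₁ r)))
             , proj₂ sB x (λ y q → p y (λ x' r → q x' (proj₂ r))))

  _∨G_ : 𝒢X → 𝒢X → 𝒢X
  (A , _) ∨G (B , _) = ⊥ ((λ x → A x ⊎ B x) ⊥) , closure-stable ((λ x → A x ⊎ B x) ⊥)

  ⊤G : 𝒢X
  ⊤G = (λ _ → ⊤) , (λ x _ y q → q x tt) , (λ x _ → tt)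

  ⊥G : 𝒢X
  ⊥G = ⊥ ((λ (_ : X) → Empty) ⊥) , closure-stable ((λ (_ : X) → Empty) ⊥)

  _⇒G_ : 𝒢X → 𝒢X → 𝒢X
  (A , _) ⇒G (C , _) = ⊥ (((⊥ R) ⊥)) , closure-stable ((⊥ R) ⊥)
    where
    R : Sub Y
    R y = ∃ λ x → ∃ λ v → A x × (C ⊥) v × T y x v

{-# OPTIONS --safe #-}
-- The operation _⇒G_ is the stable set of all z with z T' x v for every
-- x ∈ A and v ∈ C^⊥. Axiom (F4) says that z T' x v is a Galois-closed
-- condition in x and in v separately, so it survives the closures that form
-- A ∨ B and (B ∩ C)^⊥; this gives (A1) and (A2). Axiom (F0) identifies
-- "z T' x v for all z" with x ↿ v, which gives (A3).
module Submission where

open import Defs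
open import Data.Product using (_,_; proj₁; proj₂)
open import Data.Sum using (inj₁; inj₂)
open import Data.Unit using (tt)
open import Function.Bundles using (_⇔_; mk⇔; Equivalence)
open import Relation.Unary using (_∪_; _∩_)
open import Relation.Binary.Structures using (IsPartialOrder)
open import Relation.Binary.Definitions using (Minimum)
open import Relation.Binary.Lattice.Definitions using (Supremum; Infimum)
open import Relation.Binary.Lattice.Structures using (IsBoundedLattice)

module GaloisConnection (F : SortedFrame) where
  open SortedFrame F

  ⊥-antitone : {U V : Sub X} → U ⊆ V → (V ⊥) ⊆ (U ⊥)
  ⊥-antitone U⊆V y q x u = q x (U⊆V x u)

  ⊆-closure : {U : Sub X} → U ⊆ ⊥ (U ⊥)
  ⊆-closure x u y q = q x u

  closure-least : {U S : Sub X} → IsStable S → U ⊆ S → ⊥ (U ⊥) ⊆ S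
  closure-least {U} {S} S-stable U⊆S x p =
    proj₂ S-stable x (λ y q → p y (⊥-antitone {U} {S} U⊆S y q))

  co-closure-least : {V S : Sub Y} → IsCoStable S → V ⊆ S → (⊥ V) ⊥ ⊆ S
  co-closure-least S-costable V⊆S y q =
    proj₂ S-costable y (λ x p → q x (λ v v∈V → p v (V⊆S v v∈V)))

  ⊥-∩-⊆ : {B C : Sub X} → IsStable B → IsStable C →
          ((B ∩ C) ⊥) ⊆ (⊥ ((B ⊥) ∪ (C ⊥))) ⊥
  ⊥-∩-⊆ {B} {C} B-stable C-stable = ⊥-antitone {⊥ ((B ⊥) ∪ (C ⊥))} {B ∩ C}
    (λ x p → proj₂ B-stable x (λ y q → p y (inj₁ q))
           , proj₂ C-stable x (λ y q → p y (inj₂ q)))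

module _ (𝔉 : ImplicativeFrame) where
  open ImplicativeFrame 𝔉
  open ComplexAlgebra 𝔉
  open GaloisConnection frame

  ⊆G-isPartialOrder : IsPartialOrder _≈G_ _⊆G_
  ⊆G-isPartialOrder = record
    { isPreorder = record
      { isEquivalence = record
        { refl  = (λ _ p → p) , (λ _ p → p)
        ; sym   = λ (A⊆B , B⊆A) → B⊆A , A⊆B
        ; trans = λ (A⊆B , B⊆A) (B⊆C , C⊆B) →
                    (λ x p → B⊆C x (A⊆B x p)) , (λ x p → B⊆A x (C⊆B x p)) }
      ; reflexive = proj₁
      ; trans     = λ A⊆B B⊆C x p → B⊆C x (A⊆B x p) }
    ; antisym = _,_ }

  ∨G-supremum : Supremum _⊆G_ _∨G_
  ∨G-supremum (A , _) (B , _) =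
      (λ x a → ⊆-closure {A ∪ B} x (inj₁ a))
    , (λ x b → ⊆-closure {A ∪ B} x (inj₂ b))
    , λ (C , C-stable) A⊆C B⊆C → closure-least {A ∪ B} {C} C-stable
        λ { x (inj₁ a) → A⊆C x a ; x (inj₂ b) → B⊆C x b }

  ∩G-infimum : Infimum _⊆G_ _∩G_
  ∩G-infimum _ _ = (λ _ → proj₁) , (λ _ → proj₂)
                 , λ _ C⊆A C⊆B x c → C⊆A x c , C⊆B x c

  ⊥G-minimum : Minimum _⊆G_ ⊥G
  ⊥G-minimum (_ , C-stable) = closure-least C-stable (λ _ ())

  ⊆G-isBoundedLattice : IsBoundedLattice _≈G_ _⊆G_ _∨G_ _∩G_ ⊤G ⊥G
  ⊆G-isBoundedLattice = record
    { isLattice = record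
      { isPartialOrder = ⊆G-isPartialOrder
      ; supremum       = ∨G-supremum
      ; infimum        = ∩G-infimum }
    ; maximum = λ _ _ _ → tt
    ; minimum = ⊥G-minimum }

  T'-implies : Sub X → Sub X → Sub X
  T'-implies A C z = ∀ x v → A x → (C ⊥) v → T' z x v

  ⇒G-intro : (A C : 𝒢X) → T'-implies (proj₁ A) (proj₁ C) ⊆ proj₁ (A ⇒G C)
  ⇒G-intro _ _ z H y q = q z λ { y′ (x , v , a , c , t) → H x v a c y′ t }

  ⇒G-elim : (A C : 𝒢X) → proj₁ (A ⇒G C) ⊆ T'-implies (proj₁ A) (proj₁ C)
  ⇒G-elim _ _ z m x v a c y t = m y (λ _ p → p y (x , v , a , c , t))

  ⇒G-antitoneˡ : ∀ a b c → a ⊆G b → (b ⇒G c) ⊆G (a ⇒G c)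
  ⇒G-antitoneˡ a b c a⊆b z m =
    ⇒G-intro a c z λ x v x∈a → ⇒G-elim b c z m x v (a⊆b x x∈a)

  ⇒G-monotoneʳ : ∀ a b c → b ⊆G c → (a ⇒G b) ⊆G (a ⇒G c)
  ⇒G-monotoneʳ a b c b⊆c z m =
    ⇒G-intro a c z λ x v x∈a v∈c⊥ →
      ⇒G-elim a b z m x v x∈a (⊥-antitone {proj₁ b} {proj₁ c} b⊆c v v∈c⊥)

  T'-implies-∪ : ∀ {A B C z} → T'-implies A C z → T'-implies B C z →
                 T'-implies (⊥ ((A ∪ B) ⊥)) C z
  T'-implies-∪ {A} {B} {z = z} HA HB x v x∈A∨B v∈C⊥ =
    closure-least {A ∪ B} (proj₁ (F4 z x v))
      (λ { x₁ (inj₁ a) → HA x₁ v a v∈C⊥ ; x₁ (inj₂ b) → HB x₁ v b v∈C⊥ })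
      x x∈A∨B

  T'-implies-∩ : ∀ {A B C z} → IsStable B → IsStable C →
                 T'-implies A B z → T'-implies A C z → T'-implies A (B ∩ C) z
  T'-implies-∩ {B = B} {C} {z} B-stable C-stable HB HC x v x∈A v∈B∩C⊥ =
    co-closure-least {(B ⊥) ∪ (C ⊥)} (proj₂ (F4 z x v))
      (λ { v₁ (inj₁ q) → HB x v₁ x∈A q ; v₁ (inj₂ q) → HC x v₁ x∈A q })
      v (⊥-∩-⊆ B-stable C-stable v v∈B∩C⊥)

  ⇒G-∨G-distrib : ∀ a b c → ((a ∨G b) ⇒G c) ≈G ((a ⇒G c) ∩G (b ⇒G c))
  ⇒G-∨G-distrib a b c =
      (λ z m → ⇒G-antitoneˡ a (a ∨G b) c a⊆a∨b z m
             , ⇒G-antitoneˡ b (a ∨G b) c b⊆a∨b z m)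
    , λ z (ma , mb) → ⇒G-intro (a ∨G b) c z
        (T'-implies-∪ {proj₁ a} {proj₁ b} (⇒G-elim a c z ma) (⇒G-elim b c z mb))
    where
    a⊆a∨b : a ⊆G (a ∨G b)
    a⊆a∨b = proj₁ (∨G-supremum a b)
    b⊆a∨b : b ⊆G (a ∨G b)
    b⊆a∨b = proj₁ (proj₂ (∨G-supremum a b))

  ⇒G-∩G-distrib : ∀ a b c → (a ⇒G (b ∩G c)) ≈G ((a ⇒G b) ∩G (a ⇒G c))
  ⇒G-∩G-distrib a b@(_ , B-stable) c@(_ , C-stable) =
      (λ z m → ⇒G-monotoneʳ a (b ∩G c) b (λ _ → proj₁) z m
             , ⇒G-monotoneʳ a (b ∩G c) c (λ _ → proj₂) z m)
    , λ z (mb , mc) → ⇒G-intro a (b ∩G c) z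
        (T'-implies-∩ B-stable C-stable (⇒G-elim a b z mb) (⇒G-elim a c z mc))

  ⊆G⇔⊤G⊆G⇒G : ∀ a b → (a ⊆G b) ⇔ (⊤G ⊆G (a ⇒G b))
  ⊆G⇔⊤G⊆G⇒G a b@(_ , B-stable) = mk⇔
    (λ A⊆B z _ → ⇒G-intro a b z λ x v x∈A v∈B⊥ →
        Equivalence.to (F0 x v) (v∈B⊥ x (A⊆B x x∈A)) z)
    (λ ⊤⊆A⇒B x x∈A → proj₂ B-stable x λ v v∈B⊥ →
        Equivalence.from (F0 x v) (λ u → ⇒G-elim a b u (⊤⊆A⇒B u tt) x v x∈A v∈B⊥))

corollary3p7 : (𝔉 : ImplicativeFrame) →
    let open ComplexAlgebra 𝔉 in
    IsIntegralImplicativeLattice _≈G_ _⊆G_ _∨G_ _∩G_ ⊤G ⊥G _⇒G_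
corollary3p7 𝔉 = record
  { isBoundedLattice = ⊆G-isBoundedLattice 𝔉
  ; A1 = ⇒G-∨G-distrib 𝔉
  ; A2 = ⇒G-∩G-distrib 𝔉
  ; A3 = ⊆G⇔⊤G⊆G⇒G 𝔉
  }
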